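{- Let $h(n) = 2^{n!}$. Suppose $A \subseteq \mathbb{N}$ is an oracle that computes a function $x\colon \mathbb{N}\to\mathbb{N}$ such that for every computable function $y\colon\mathbb{N}\to\mathbb{N}$ with $y(n) < h(n)$ for all $n$, there are infinitely many $n$ with $x(n) = y(n)$. Then $A$ computes a set $X \subseteq \mathbb{N}$ such that for every computable set $S \subseteq \mathbb{N}$, $\underline{\eta}(X \leftrightarrow S) = 0$. In other words, $\mathcal{D}(\neq^*, 2^{n!}) \subseteq \mathcal{D}(\sim_0)$.
   Context: Sets of natural numbers are identified with infinite bit sequences. For $Z \subseteq \mathbb{N}$, the lower density is $\underline{\eta}(Z) = \liminf_n \frac{|Z \cap [0,n)|}{n}$. For sets $X, S \subseteq \mathbb{N}$, $X \leftrightarrow S$ denotes the set $\{n : X(n) = S(n)\}$ (the complement of the symmetric difference). For a computable function $h$, $\mathcal{D}(\neq^*, h)$ is the class of oracles $A$ that compute a function $x$ such that $\exists^\infty n\, x(n) = y(n)$ for each computable function $y < h$. For $p \in [0,1]$, $\mathcal{D}(\sim_p)$ is the class of oracles $A$ that compute a set $X$ such that for every computable set $S$, $\underline{\eta}(X \leftrightarrow S) \le p$. -}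

module Defs where

open import Data.Nat using (ℕ; zero; suc; _+_; _*_; _^_; _≤_; _<_; _!)

open import Data.Bool using (Bool; true; false; not; _xor_; if_then_else_)
open import Data.Fin using (Fin)
open import Data.Vec using (Vec; []; _∷_; lookup)
open import Data.Product using (Σ; ∃; _×_)
open import Relation.Binary.PropositionalEquality using (_≡_)

Set⊆ℕ : Set
Set⊆ℕ = ℕ → Bool

-- Oracle computation: partial recursive functions relative to an oracle
-- (Kleene's μ-recursive functions with an extra oracle basic function).

data Code : ℕ → Set where
  zeroᶜ   : Code 1
  succᶜ   : Code 1
  projᶜ   : ∀ {k} → Fin k → Code k
  oracleᶜ : Code 1
  compᶜ   : ∀ {k m} → Code k → Vec (Code m) k → Code m
  precᶜ   : ∀ {k} → Code k → Code (suc (suc k)) → Code (suc k)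
  μᶜ      : ∀ {k} → Code (suc k) → Code k

bit : Bool → ℕ
bit true  = 1
bit false = 0

mutual
  data Eval (A : Set⊆ℕ) : ∀ {k} → Code k → Vec ℕ k → ℕ → Set where
    e-zero   : ∀ {x} → Eval A zeroᶜ (x ∷ []) 0
    e-succ   : ∀ {x} → Eval A succᶜ (x ∷ []) (suc x)
    e-proj   : ∀ {k} {i : Fin k} {xs} → Eval A (projᶜ i) xs (lookup xs i)
    e-oracle : ∀ {x} → Eval A oracleᶜ (x ∷ []) (bit (A x))
    e-comp   : ∀ {k m} {f : Code k} {gs : Vec (Code m) k} {xs ys v} →
               EvalAll A gs xs ys → Eval A f ys v → Eval A (compᶜ f gs) xs v
    e-prec0  : ∀ {k} {g : Code k} {h xs v} →
               Eval A g xs v → Eval A (precᶜ g h) (0 ∷ xs) v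
    e-precS  : ∀ {k} {g : Code k} {h n xs u v} →
               Eval A (precᶜ g h) (n ∷ xs) u → Eval A h (n ∷ u ∷ xs) v →
               Eval A (precᶜ g h) (suc n ∷ xs) v
    e-μ      : ∀ {k} {f : Code (suc k)} {xs n} →
               Eval A f (n ∷ xs) 0 → Below A f xs n → Eval A (μᶜ f) xs n

  data EvalAll (A : Set⊆ℕ) {m : ℕ} : ∀ {k} → Vec (Code m) k → Vec ℕ m → Vec ℕ k → Set where
    []ᵉ  : ∀ {xs} → EvalAll A [] xs []
    _∷ᵉ_ : ∀ {k} {g : Code m} {gs : Vec (Code m) k} {xs v vs} →
           Eval A g xs v → EvalAll A gs xs vs → EvalAll A (g ∷ gs) xs (v ∷ vs)

  data Below (A : Set⊆ℕ) {k : ℕ} (f : Code (suc k)) (xs : Vec ℕ k) : ℕ → Set where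
    b-zero : Below A f xs 0
    b-suc  : ∀ {n w} → Below A f xs n → Eval A f (n ∷ xs) (suc w) → Below A f xs (suc n)

ComputableIn : Set⊆ℕ → (ℕ → ℕ) → Set
ComputableIn A f = Σ (Code 1) λ c → ∀ n → Eval A c (n ∷ []) (f n)

∅ : Set⊆ℕ
∅ _ = false

Computable : (ℕ → ℕ) → Set
Computable = ComputableIn ∅

ComputableSetIn : Set⊆ℕ → Set⊆ℕ → Set
ComputableSetIn A X = ComputableIn A (λ n → bit (X n))

ComputableSet : Set⊆ℕ → Set
ComputableSet = ComputableSetIn ∅

count : Set⊆ℕ → ℕ → ℕ
count Z zero    = 0
count Z (suc n) = count Z n + bit (Z n)

-- lower density of Z equals 0:  liminf_n |Z ∩ [0,n)|/n = 0, i.e.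
-- for every ε = 1/(k+1) and every N there is n ≥ N with |Z∩[0,n)|/n < ε.
LowerDensityZero : Set⊆ℕ → Set
LowerDensityZero Z = ∀ k N → ∃ λ n → N ≤ n × count Z n * suc k < n

_↔ˢ_ : Set⊆ℕ → Set⊆ℕ → Set⊆ℕ
(X ↔ˢ S) n = not (X n xor S n)

InfinitelyOften : (ℕ → Set) → Set
InfinitelyOften P = ∀ N → ∃ λ n → N ≤ n × P n

DNeq : (ℕ → ℕ) → Set⊆ℕ → Set
DNeq h A = Σ (ℕ → ℕ) λ x → ComputableIn A x ×
  (∀ (y : ℕ → ℕ) → Computable y → (∀ n → y n < h n) →
     InfinitelyOften (λ n → x n ≡ y n))

DSim0 : Set⊆ℕ → Set
DSim0 A = Σ Set⊆ℕ λ X → ComputableSetIn A X ×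
  (∀ (S : Set⊆ℕ) → ComputableSet S → LowerDensityZero (X ↔ˢ S))

hFact : ℕ → ℕ
hFact n = 2 ^ (n !)

module Submission where

-- Cut ℕ into consecutive blocks, block n having length n! and starting at
-- blockStart n = 0! + ... + (n-1)!, so that each block is much longer than
-- all earlier ones together.  On block n let X be the complement of the
-- binary digits of x n.  For a computable S, the number blockCode S n whose
-- n! binary digits are S restricted to block n is computable and below
-- 2^(n!), so x guesses it at infinitely many n; on each such block X
-- disagrees with S everywhere, and at the end of the block the density of
-- X ↔ S is at most blockStart n / blockStart (n+1), which tends to 0.

open import Defs
open import Data.Nat
open import Data.Nat.Properties
open import Data.Bool using (true; false; not; _xor_)
open import Data.Fin using (Fin) renaming (zero to fzero; suc to fsuc)
open import Data.Vec using (Vec; []; _∷_; lookup; map)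
open import Data.Vec.Relation.Unary.All using (All; []; _∷_)
open import Data.Product using (Σ; _,_; _×_)
open import Data.Sum using (inj₁; inj₂)
open import Data.Empty using (⊥-elim)
open import Relation.Nullary using (yes; no)
open import Relation.Binary.Definitions using (tri<; tri≈; tri>)
open import Relation.Binary.PropositionalEquality

Fun : ℕ → Set
Fun k = Vec ℕ k → ℕ

Computes : Set⊆ℕ → ∀ {k} → Fun k → Set
Computes A {k} f = Σ (Code k) λ c → ∀ xs → Eval A c xs (f xs)

fun₁ : (ℕ → ℕ) → Fun 1
fun₁ f (a ∷ []) = f a

fun₂ : (ℕ → ℕ → ℕ) → Fun 2
fun₂ f (a ∷ b ∷ []) = f a b

module _ {A : Set⊆ℕ} where

  Computes-resp : ∀ {k} {f g : Fun k} → (∀ xs → f xs ≡ g xs) → Computes A f → Computes A g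
  Computes-resp f≗g (c , e) = c , λ xs → subst (Eval A c xs) (f≗g xs) (e xs)

  computes⇒computableIn : ∀ {f} → Computes A (fun₁ f) → ComputableIn A f
  computes⇒computableIn (c , e) = c , λ n → e (n ∷ [])

  computableIn⇒computes : ∀ {f} → ComputableIn A f → Computes A (fun₁ f)
  computableIn⇒computes (c , e) = c , λ { (n ∷ []) → e n }

  zeroFn : ∀ {k} → Computes A {k} (λ _ → 0)
  zeroFn = μᶜ (projᶜ fzero) , λ xs → e-μ e-proj b-zero

  succFn : Computes A (fun₁ suc)
  succFn = succᶜ , λ { (a ∷ []) → e-succ }

  proj : ∀ {k} (i : Fin k) → Computes A (λ xs → lookup xs i)
  proj i = projᶜ i , λ xs → e-proj

  arg₀ : ∀ {k} → Computes A {suc k} (λ xs → lookup xs fzero)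
  arg₀ = proj fzero

  arg₁ : ∀ {k} → Computes A {2 + k} (λ xs → lookup xs (fsuc fzero))
  arg₁ = proj (fsuc fzero)

  arg₂ : ∀ {k} → Computes A {3 + k} (λ xs → lookup xs (fsuc (fsuc fzero)))
  arg₂ = proj (fsuc (fsuc fzero))

  compose : ∀ {k m} {f : Fun k} {gs : Vec (Fun m) k} →
            Computes A f → All (Computes A) gs →
            Computes A (λ xs → f (map (λ g → g xs) gs))
  compose {m = m} (cf , ef) cgs = compᶜ cf (codes cgs) , λ xs → e-comp (evalAll cgs xs) (ef _)
    where
    codes : ∀ {k} {gs : Vec (Fun m) k} → All (Computes A) gs → Vec (Code m) k
    codes []             = []
    codes ((c , _) ∷ cs) = c ∷ codes cs

    evalAll : ∀ {k} {gs : Vec (Fun m) k} (cgs : All (Computes A) gs) xs →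
              EvalAll A (codes cgs) xs (map (λ g → g xs) gs)
    evalAll []             xs = []ᵉ
    evalAll ((_ , e) ∷ cs) xs = e xs ∷ᵉ evalAll cs xs

  primRec : ∀ {k} {g : Fun k} {h : Fun (2 + k)} {F : Fun (suc k)} →
            Computes A g → Computes A h →
            (∀ xs → F (0 ∷ xs) ≡ g xs) →
            (∀ n xs → F (suc n ∷ xs) ≡ h (n ∷ F (n ∷ xs) ∷ xs)) →
            Computes A F
  primRec {F = F} (cg , eg) (ch , eh) F-zero F-suc = precᶜ cg ch , λ { (n ∷ xs) → run n xs }
    where
    run : ∀ n xs → Eval A (precᶜ cg ch) (n ∷ xs) (F (n ∷ xs))
    run zero    xs = subst (Eval A _ _) (sym (F-zero xs)) (e-prec0 (eg xs))
    run (suc n) xs = subst (Eval A _ _) (sym (F-suc n xs)) (e-precS (run n xs) (eh _))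

  constFn : ∀ {k} c → Computes A {k} (λ _ → c)
  constFn zero    = zeroFn
  constFn (suc c) = compose succFn (constFn c ∷ [])

  swap₂ : ∀ {f} → Computes A (fun₂ f) → Computes A (fun₂ λ a b → f b a)
  swap₂ cf = Computes-resp (λ { (a ∷ b ∷ []) → refl }) (compose cf (arg₁ ∷ arg₀ ∷ []))

  addFn : Computes A (fun₂ _+_)
  addFn = primRec arg₀ (compose succFn (arg₁ ∷ []))
            (λ { (a ∷ []) → refl }) (λ { n (a ∷ []) → refl })

  mulFn : Computes A (fun₂ _*_)
  mulFn = primRec zeroFn (compose addFn (arg₂ ∷ arg₁ ∷ []))
            (λ { (a ∷ []) → refl }) (λ { n (a ∷ []) → refl })

  predFn : Computes A (fun₁ pred)
  predFn = primRec zeroFn arg₀ (λ { [] → refl }) (λ { n [] → refl })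

  monusFn : Computes A (fun₂ _∸_)
  monusFn = swap₂ (primRec arg₀ (compose predFn (arg₁ ∷ []))
              (λ { (a ∷ []) → refl }) (λ { n (a ∷ []) → sym (pred[m∸n]≡m∸[1+n] a n) }))

  factorialFn : Computes A (fun₁ _!)
  factorialFn = primRec (constFn 1)
                  (compose mulFn (compose succFn (arg₀ ∷ []) ∷ arg₁ ∷ []))
                  (λ { [] → refl }) (λ { n [] → refl })

⌈n/2⌉≡n∸⌊n/2⌋ : ∀ n → ⌈ n /2⌉ ≡ n ∸ ⌊ n /2⌋
⌈n/2⌉≡n∸⌊n/2⌋ n = begin
  ⌈ n /2⌉                        ≡⟨ sym (m+n∸m≡n ⌊ n /2⌋ ⌈ n /2⌉) ⟩
  ⌊ n /2⌋ + ⌈ n /2⌉ ∸ ⌊ n /2⌋    ≡⟨ cong (_∸ ⌊ n /2⌋) (⌊n/2⌋+⌈n/2⌉≡n n) ⟩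
  n ∸ ⌊ n /2⌋                    ∎
  where open ≡-Reasoning

⌊bit+2u/2⌋ : ∀ c u → ⌊ bit c + (u + u) /2⌋ ≡ u
⌊bit+2u/2⌋ false u = sym (n≡⌊n+n/2⌋ u)
⌊bit+2u/2⌋ true  u = +-cancelˡ-≡ u _ _ (trans (cong (_+ ⌈ u + u /2⌉) (n≡⌊n+n/2⌋ u))
                                                (⌊n/2⌋+⌈n/2⌉≡n (u + u)))

lowBit : ℕ → ℕ
lowBit v = v ∸ (⌊ v /2⌋ + ⌊ v /2⌋)

lowBit-bit+2u : ∀ c u → lowBit (bit c + (u + u)) ≡ bit c
lowBit-bit+2u c u = begin
  bit c + (u + u) ∸ (⌊ bit c + (u + u) /2⌋ + ⌊ bit c + (u + u) /2⌋)
    ≡⟨ cong (λ h → bit c + (u + u) ∸ (h + h)) (⌊bit+2u/2⌋ c u) ⟩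
  bit c + (u + u) ∸ (u + u)
    ≡⟨ m+n∸n≡m (bit c) (u + u) ⟩
  bit c ∎
  where open ≡-Reasoning

shiftR : ℕ → ℕ → ℕ
shiftR zero    v = v
shiftR (suc j) v = ⌊ shiftR j v /2⌋

digit : ℕ → ℕ → ℕ
digit v j = lowBit (shiftR j v)

module _ {A : Set⊆ℕ} where
  -- ⌊ n+1 /2⌋ = n ∸ ⌊ n /2⌋ makes halving primitive recursive.
  halfFn : Computes A (fun₁ ⌊_/2⌋)
  halfFn = primRec zeroFn (compose monusFn (arg₀ ∷ arg₁ ∷ []))
             (λ { [] → refl }) (λ { n [] → ⌈n/2⌉≡n∸⌊n/2⌋ n })

  digitFn : Computes A (fun₂ digit)
  digitFn = swap₂ (Computes-resp (λ { (j ∷ v ∷ []) → refl })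
              (compose lowBitFn (shiftFn ∷ [])))
    where
    lowBitFn : Computes A (fun₁ lowBit)
    lowBitFn = Computes-resp (λ { (v ∷ []) → refl })
      (compose monusFn (arg₀ ∷ compose addFn (compose halfFn (arg₀ ∷ []) ∷ compose halfFn (arg₀ ∷ []) ∷ []) ∷ []))

    shiftFn : Computes A (fun₂ shiftR)
    shiftFn = primRec arg₀ (compose halfFn (arg₁ ∷ []))
                (λ { (v ∷ []) → refl }) (λ { j (v ∷ []) → refl })

bit≤1 : ∀ b → bit b ≤ 1
bit≤1 false = z≤n
bit≤1 true  = s≤s z≤n

-- window S t e is the t-digit binary number whose digits, least significant
-- first, are the bits of S on the interval [e ∸ t, e).
window : Set⊆ℕ → ℕ → ℕ → ℕ
window S zero    e = 0
window S (suc t) e = bit (S (e ∸ suc t)) + (window S t e + window S t e)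

window-< : ∀ S t e → window S t e < 2 ^ t
window-< S zero    e = s≤s z≤n
window-< S (suc t) e = begin-strict
  bit c + (w + w)      ≤⟨ +-monoˡ-≤ (w + w) (bit≤1 c) ⟩
  1 + (w + w)          <⟨ n<1+n _ ⟩
  2 + (w + w)          ≡⟨ cong suc (sym (+-suc w w)) ⟩
  suc w + suc w        ≤⟨ +-mono-≤ (window-< S t e) (window-< S t e) ⟩
  2 ^ t + 2 ^ t        ≡⟨ cong (2 ^ t +_) (sym (+-identityʳ (2 ^ t))) ⟩
  2 ^ suc t            ∎
  where
  open ≤-Reasoning
  c = S (e ∸ suc t)
  w = window S t e

-- Halving drops the lowest digit, i.e. the first bit of the window.
half-window : ∀ S t e → ⌊ window S t e /2⌋ ≡ window S (pred t) e
half-window S zero    e = refl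
half-window S (suc t) e = ⌊bit+2u/2⌋ (S (e ∸ suc t)) (window S t e)

shiftR-window : ∀ S j t e → shiftR j (window S t e) ≡ window S (t ∸ j) e
shiftR-window S zero    t e = refl
shiftR-window S (suc j) t e = begin
  ⌊ shiftR j (window S t e) /2⌋   ≡⟨ cong ⌊_/2⌋ (shiftR-window S j t e) ⟩
  ⌊ window S (t ∸ j) e /2⌋        ≡⟨ half-window S (t ∸ j) e ⟩
  window S (pred (t ∸ j)) e       ≡⟨ cong (λ r → window S r e) (pred[m∸n]≡m∸[1+n] t j) ⟩
  window S (t ∸ suc j) e          ∎
  where open ≡-Reasoning

digit-window : ∀ S {j t e} → j < t → t ≤ e → digit (window S t e) j ≡ bit (S (e ∸ t + j))
digit-window S {j} {t} {e} j<t t≤e = begin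
  lowBit (shiftR j (window S t e))          ≡⟨ cong lowBit (shiftR-window S j t e) ⟩
  lowBit (window S (t ∸ j) e)               ≡⟨ cong (λ r → lowBit (window S r e)) t∸j≡1+r ⟩
  lowBit (window S (suc r) e)               ≡⟨ lowBit-bit+2u (S (e ∸ suc r)) (window S r e) ⟩
  bit (S (e ∸ suc r))                       ≡⟨ cong (λ p → bit (S (e ∸ p))) (sym t∸j≡1+r) ⟩
  bit (S (e ∸ (t ∸ j)))                     ≡⟨ cong (λ p → bit (S p)) e∸[t∸j]≡e∸t+j ⟩
  bit (S (e ∸ t + j))                       ∎
  where
  open ≡-Reasoning
  r = t ∸ suc j
  t∸j≡1+r : t ∸ j ≡ suc r
  t∸j≡1+r = +-∸-assoc 1 j<t
  e∸[t∸j]≡e∸t+j : e ∸ (t ∸ j) ≡ e ∸ t + j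
  e∸[t∸j]≡e∸t+j = begin
    e ∸ (t ∸ j)                 ≡⟨ cong (_∸ (t ∸ j)) (sym (m∸n+n≡m t≤e)) ⟩
    (e ∸ t) + t ∸ (t ∸ j)       ≡⟨ +-∸-assoc (e ∸ t) (m∸n≤m t j) ⟩
    (e ∸ t) + (t ∸ (t ∸ j))     ≡⟨ cong ((e ∸ t) +_) (m∸[m∸n]≡n (<⇒≤ j<t)) ⟩
    e ∸ t + j                   ∎

windowFn : ∀ {A S} → ComputableSetIn A S → Computes A (fun₂ (window S))
windowFn cS = primRec zeroFn
  (compose addFn (compose (computableIn⇒computes cS)
                      (compose monusFn (arg₂ ∷ compose succFn (arg₀ ∷ []) ∷ []) ∷ [])
                 ∷ compose addFn (arg₁ ∷ arg₁ ∷ []) ∷ []))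
  (λ { (e ∷ []) → refl }) (λ { t (e ∷ []) → refl })

blockStart : ℕ → ℕ
blockStart zero    = 0
blockStart (suc n) = blockStart n + n !

InBlock : ℕ → ℕ → Set
InBlock m n = blockStart n ≤ m × m < blockStart (suc n)

blockStart-< : ∀ n → blockStart n < blockStart (suc n)
blockStart-< n = begin-strict
  blockStart n       <⟨ m<m+n (blockStart n) (s≤s z≤n) ⟩
  blockStart n + 1   ≤⟨ +-monoʳ-≤ (blockStart n) (1≤n! n) ⟩
  blockStart n + n ! ∎
  where open ≤-Reasoning

blockStart-mono : ∀ {m n} → m ≤ n → blockStart m ≤ blockStart n
blockStart-mono {n = zero}  z≤n   = ≤-refl
blockStart-mono {m} {suc n} m≤1+n with m≤n⇒m<n∨m≡n m≤1+n
... | inj₁ m<1+n = ≤-trans (blockStart-mono (s≤s⁻¹ m<1+n)) (<⇒≤ (blockStart-< n))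
... | inj₂ refl  = ≤-refl

n≤blockStart : ∀ n → n ≤ blockStart n
n≤blockStart zero    = z≤n
n≤blockStart (suc n) = <-≤-trans (s≤s (n≤blockStart n)) (blockStart-< n)

blockStart≤! : ∀ n → blockStart n ≤ n !
blockStart≤! zero          = z≤n
blockStart≤! (suc zero)    = ≤-refl
blockStart≤! (suc (suc n)) = begin
  blockStart (suc n) + suc n !   ≤⟨ +-monoˡ-≤ (suc n !) (blockStart≤! (suc n)) ⟩
  suc n ! + suc n !              ≤⟨ +-monoʳ-≤ (suc n !) (m≤m+n (suc n !) (n * suc n !)) ⟩
  suc (suc n) !                  ∎
  where open ≤-Reasoning

InBlock-unique : ∀ {m a b} → InBlock m a → InBlock m b → a ≡ b
InBlock-unique {m} {a} {b} (a≤m , m<a') (b≤m , m<b') with <-cmp a b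
... | tri≈ _ a≡b _ = a≡b
... | tri< a<b _ _ = ⊥-elim (<-irrefl refl (<-≤-trans m<a' (≤-trans (blockStart-mono a<b) b≤m)))
... | tri> _ _ b<a = ⊥-elim (<-irrefl refl (<-≤-trans m<b' (≤-trans (blockStart-mono b<a) a≤m)))

leBit : ℕ → ℕ → ℕ
leBit a b = 1 ∸ (a ∸ b)

blockOf : ℕ → ℕ
blockOf zero    = 0
blockOf (suc m) = blockOf m + leBit (blockStart (suc (blockOf m))) (suc m)

blockOf-inBlock : ∀ m → InBlock m (blockOf m)
blockOf-inBlock zero = z≤n , s≤s z≤n
blockOf-inBlock (suc m) with blockOf-inBlock m | blockStart (suc (blockOf m)) ≤? suc m
... | (_ , m<s') | yes s'≤1+m = subst (InBlock (suc m)) (sym next)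
  (s'≤1+m , subst (_< blockStart (suc (suc n))) (sym (≤-antisym m<s' s'≤1+m)) (blockStart-< (suc n)))
  where
  n = blockOf m
  next : blockOf (suc m) ≡ suc n
  next = trans (cong (λ d → n + (1 ∸ d)) (m≤n⇒m∸n≡0 s'≤1+m)) (+-comm n 1)
... | (s≤m , _) | no s'≰1+m = subst (InBlock (suc m)) (sym same)
  (m≤n⇒m≤1+n s≤m , ≰⇒> s'≰1+m)
  where
  n = blockOf m
  same : blockOf (suc m) ≡ n
  same = trans (cong (n +_) (m≤n⇒m∸n≡0 (m<n⇒0<n∸m (≰⇒> s'≰1+m)))) (+-identityʳ n)

blockOf-blockStart+ : ∀ n {j} → j < n ! → blockOf (blockStart n + j) ≡ n
blockOf-blockStart+ n {j} j<n! =
  InBlock-unique (blockOf-inBlock (blockStart n + j)) (m≤m+n (blockStart n) j , +-monoʳ-< (blockStart n) j<n!)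

module _ {A : Set⊆ℕ} where
  blockStartFn : Computes A (fun₁ blockStart)
  blockStartFn = primRec zeroFn (compose addFn (arg₁ ∷ compose factorialFn (arg₀ ∷ []) ∷ []))
                   (λ { [] → refl }) (λ { n [] → refl })

  blockOfFn : Computes A (fun₁ blockOf)
  blockOfFn = primRec zeroFn
    (compose addFn (arg₁ ∷ compose monusFn (constFn 1 ∷ compose monusFn
       (compose blockStartFn (compose succFn (arg₁ ∷ []) ∷ []) ∷ compose succFn (arg₀ ∷ []) ∷ []) ∷ []) ∷ []))
    (λ { [] → refl }) (λ { n [] → refl })

count-≤ : ∀ Z n → count Z n ≤ n
count-≤ Z zero    = z≤n
count-≤ Z (suc n) = begin
  count Z n + bit (Z n)   ≤⟨ +-mono-≤ (count-≤ Z n) (bit≤1 (Z n)) ⟩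
  n + 1                   ≡⟨ +-comm n 1 ⟩
  suc n                   ∎
  where open ≤-Reasoning

count-gap : ∀ Z a t → (∀ j → j < t → Z (a + j) ≡ false) → count Z (a + t) ≡ count Z a
count-gap Z a zero    _   = cong (count Z) (+-identityʳ a)
count-gap Z a (suc t) gap = begin
  count Z (a + suc t)                  ≡⟨ cong (count Z) (+-suc a t) ⟩
  count Z (a + t) + bit (Z (a + t))    ≡⟨ cong₂ _+_ (count-gap Z a t (λ j j<t → gap j (m<n⇒m<1+n j<t)))
                                                    (cong bit (gap t ≤-refl)) ⟩
  count Z a + 0                        ≡⟨ +-identityʳ (count Z a) ⟩
  count Z a                            ∎
  where open ≡-Reasoning

gap⇒sparse : ∀ Z k a t → a * k < t → (∀ j → j < t → Z (a + j) ≡ false) →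
             count Z (a + t) * suc k < a + t
gap⇒sparse Z k a t ak<t gap = begin-strict
  count Z (a + t) * suc k   ≡⟨ cong (_* suc k) (count-gap Z a t gap) ⟩
  count Z a * suc k         ≤⟨ *-monoˡ-≤ (suc k) (count-≤ Z a) ⟩
  a * suc k                 ≡⟨ *-suc a k ⟩
  a + a * k                 <⟨ +-monoʳ-< a ak<t ⟩
  a + t                     ∎
  where open ≤-Reasoning

blockStart-negligible : ∀ k n → k + k ≤ n → blockStart (suc n) * k < suc n !
blockStart-negligible k n 2k≤n = begin-strict
  (blockStart n + n !) * k    ≤⟨ *-monoˡ-≤ k (+-monoˡ-≤ (n !) (blockStart≤! n)) ⟩
  (n ! + n !) * k             ≡⟨ *-distribʳ-+ k (n !) (n !) ⟩
  n ! * k + n ! * k           ≡⟨ sym (*-distribˡ-+ (n !) k k) ⟩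
  n ! * (k + k)               ≤⟨ *-monoʳ-≤ (n !) 2k≤n ⟩
  n ! * n                     ≡⟨ *-comm (n !) n ⟩
  n * n !                     <⟨ +-monoˡ-< (n * n !) (1≤n! n) ⟩
  n ! + n * n !               ∎
  where open ≤-Reasoning

blockCode : Set⊆ℕ → ℕ → ℕ
blockCode S n = window S (n !) (blockStart (suc n))

blockCode-< : ∀ S n → blockCode S n < hFact n
blockCode-< S n = window-< S (n !) (blockStart (suc n))

digit-blockCode : ∀ S n {j} → j < n ! → digit (blockCode S n) j ≡ bit (S (blockStart n + j))
digit-blockCode S n {j} j<n! =
  trans (digit-window S j<n! (m≤n+m (n !) (blockStart n)))
        (cong (λ a → bit (S (a + j))) (m+n∸n≡m (blockStart n) (n !)))

blockCode-computable : ∀ {S} → ComputableSet S → Computable (blockCode S)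
blockCode-computable cS = computes⇒computableIn
  (Computes-resp (λ { (n ∷ []) → refl })
    (compose (windowFn cS) (compose factorialFn (arg₀ ∷ [])
                            ∷ compose blockStartFn (compose succFn (arg₀ ∷ []) ∷ []) ∷ [])))

diagonal : (ℕ → ℕ) → Set⊆ℕ
diagonal x m = digit (x (blockOf m)) (m ∸ blockStart (blockOf m)) ≡ᵇ 0

bit[d≡ᵇ0] : ∀ d → bit (d ≡ᵇ 0) ≡ 1 ∸ d
bit[d≡ᵇ0] zero    = refl
bit[d≡ᵇ0] (suc d) = sym (0∸n≡0 d)

diagonal-computable : ∀ {A} x → ComputableIn A x → ComputableSetIn A (diagonal x)
diagonal-computable x cx = computes⇒computableIn
  (Computes-resp (λ { (m ∷ []) → sym (bit[d≡ᵇ0] (digit (x (blockOf m)) (m ∸ blockStart (blockOf m)))) })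
    (compose monusFn (constFn 1 ∷ compose digitFn
       (compose (computableIn⇒computes cx) (compose blockOfFn (arg₀ ∷ []) ∷ [])
        ∷ compose monusFn (arg₀ ∷ compose blockStartFn (compose blockOfFn (arg₀ ∷ []) ∷ []) ∷ [])
        ∷ []) ∷ [])))

complement-disagrees : ∀ c → not ((bit c ≡ᵇ 0) xor c) ≡ false
complement-disagrees false = refl
complement-disagrees true  = refl

guess⇒disagree : ∀ x S {n} → x n ≡ blockCode S n →
                 ∀ j → j < n ! → (diagonal x ↔ˢ S) (blockStart n + j) ≡ false
guess⇒disagree x S {n} guess j j<n! =
  trans (cong (λ d → not ((d ≡ᵇ 0) xor S p)) digit≡) (complement-disagrees (S p))
  where
  open ≡-Reasoning
  p = blockStart n + j
  digit≡ : digit (x (blockOf p)) (p ∸ blockStart (blockOf p)) ≡ bit (S p)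
  digit≡ = begin
    digit (x (blockOf p)) (p ∸ blockStart (blockOf p))
      ≡⟨ cong (λ b → digit (x b) (p ∸ blockStart b)) (blockOf-blockStart+ n j<n!) ⟩
    digit (x n) (p ∸ blockStart n)   ≡⟨ cong₂ digit guess (m+n∸m≡n (blockStart n) j) ⟩
    digit (blockCode S n) j          ≡⟨ digit-blockCode S n j<n! ⟩
    bit (S p)                        ∎

guess⇒sparse : ∀ x S k n → k + k ≤ n → x (suc n) ≡ blockCode S (suc n) →
               count (diagonal x ↔ˢ S) (blockStart (suc (suc n))) * suc k < blockStart (suc (suc n))
guess⇒sparse x S k n 2k≤n guess =
  gap⇒sparse (diagonal x ↔ˢ S) k (blockStart (suc n)) (suc n !)
             (blockStart-negligible k n 2k≤n) (guess⇒disagree x S guess)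

-- To get density below 1/(k+1) beyond N, take a guess of blockCode S at a
-- block n+1 with N + 2k ≤ n and look at the end of that block.
mainTheorem1 : ∀ (A : Set⊆ℕ) → DNeq hFact A → DSim0 A
mainTheorem1 A (x , x-computable , x-guesses) = diagonal x , diagonal-computable x x-computable , sparse
  where
  sparse : ∀ S → ComputableSet S → LowerDensityZero (diagonal x ↔ˢ S)
  sparse S S-computable k N
    with x-guesses (blockCode S) (blockCode-computable S-computable) (blockCode-< S) (suc (N + (k + k)))
  ... | suc n , N+2k<1+n , guess =
    blockStart (suc (suc n)) , N≤ , guess⇒sparse x S k n (≤-trans (m≤n+m (k + k) N) N+2k≤n) guess
    where
    N+2k≤n : N + (k + k) ≤ n
    N+2k≤n = s≤s⁻¹ N+2k<1+n
    N≤ : N ≤ blockStart (suc (suc n))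
    N≤ = ≤-trans (m≤m+n N (k + k)) (≤-trans N+2k≤n (≤-trans (m≤n+m n 2) (n≤blockStart (2 + n))))
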